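{- Let $\overrightarrow{\pi}^c$ be a partially signed circular permutation of $\{1,\ldots,n\}$. Then $\overrightarrow{d}^c(\overrightarrow{\pi}^c)=\min\{\overrightarrow{d}(\overrightarrow{\sigma})\mid \overrightarrow{\sigma}\in\overrightarrow{\pi}^c\}$.
   Context: A partially signed linear permutation is $\overrightarrow{\pi}=(\langle\pi_1,s_1\rangle,\ldots,\langle\pi_n,s_n\rangle)$ with $(\pi_1,\ldots,\pi_n)$ a permutation of $\{1,\ldots,n\}$ and $s_i\in\{ -1,0,+1\}$. Linear reversal $\overrightarrow{\rho}(i,j)$, $1\le i\le j\le n$: reverse the entries in positions $i,\ldots,j$ and negate their signs. A linear permutation agrees in signs with $\overrightarrow{\iota}=(\langle1,+1\rangle,\ldots,\langle n,+1\rangle)$ if it equals $(\langle1,s'_1\rangle,\ldots,\langle n,s'_n\rangle)$ with all $s'_i\in\{0,+1\}$; $\overrightarrow{d}(\overrightarrow{\pi})$ is the minimum number of linear reversals transforming $\overrightarrow{\pi}$ into a permutation agreeing in signs with $\overrightarrow{\iota}$. A partially signed circular permutation $\overrightarrow{\pi}^c=(\langle\pi_1,s_1\rangle,\ldots,\langle\pi_n,s_n\rangle)$ is the class of partially signed linear permutations obtainable from $(\langle\pi_1,s_1\rangle,\ldots,\langle\pi_n,s_n\rangle)$ by rotations (cyclic shifts) and reflections, where a reflection reverses the order and negates all signs (e.g. $(\langle\pi_n,-s_n\rangle,\ldots,\langle\pi_1,-s_1\rangle)$); $\overrightarrow{\sigma}\in\overrightarrow{\pi}^c$ means $\overrightarrow{\sigma}$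 is in this class. Circular reversal $\overrightarrow{\rho}^c(i,j)$ for $i,j\in\{1,\ldots,n\}$: if $i\le j$ it acts as the linear reversal; if $i>j$ it maps $\overrightarrow{\pi}^c$ to $(\langle\pi_n,-s_n\rangle,\ldots,\langle\pi_i,-s_i\rangle,\langle\pi_{j+1},s_{j+1}\rangle,\ldots,\langle\pi_{i-1},s_{i-1}\rangle,\langle\pi_j,-s_j\rangle,\ldots,\langle\pi_1,-s_1\rangle)$. A partially signed circular permutation agrees in signs with the signed circular identity $\overrightarrow{\iota}^c=(\langle1,+1\rangle,\ldots,\langle n,+1\rangle)$ if some linear representative of it agrees in signs (equal entries position-wise, equal signs wherever its sign is nonzero) with some linear representative of $\overrightarrow{\iota}^c$. $\overrightarrow{d}^c(\overrightarrow{\pi}^c)$ is the minimum number of circular reversals transforming $\overrightarrow{\pi}^c$ into a partially signed circular permutation that agrees in signs with $\overrightarrow{\iota}^c$. -}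

module Defs where

open import Data.Nat using (ℕ; zero; suc; _∸_; _≤_; _<_)
open import Data.List using (List; []; _∷_; _++_; map; take; drop; reverse; upTo; length)
open import Data.List.Relation.Binary.Pointwise using (Pointwise)
open import Data.List.Relation.Binary.Permutation.Propositional using (_↭_)
open import Data.Product using (_×_; _,_; proj₁; ∃-syntax)
open import Data.Sum using (_⊎_)
open import Relation.Binary.PropositionalEquality using (_≡_; _≢_)
import Relation.Nullary
import Data.Nat

data Sign : Set where
  minus zer plus : Sign

negS : Sign → Sign
negS minus = plus
negS zer   = zer
negS plus  = minus

-- an entry ⟨π_i , s_i⟩ (values are 1-based naturals)
Entry : Set
Entry = ℕ × Sign

negE : Entry → Entry
negE (a , s) = (a , negS s)

PSPerm : Set
PSPerm = List Entry

IsPerm : ℕ → PSPerm → Set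
IsPerm n π = map proj₁ π ↭ map suc (upTo n)

iota : ℕ → PSPerm
iota n = map (λ i → (i , plus)) (map suc (upTo n))

EntryAgree : Entry → Entry → Set
EntryAgree (a , s) (b , t) = (a ≡ b) × (s ≢ zer → s ≡ t)

AgreesWith : PSPerm → PSPerm → Set
AgreesWith σ τ = Pointwise EntryAgree σ τ

-- linear reversal ρ(i,j), 1 ≤ i ≤ j ≤ n (positions 1-based)

linRev : ℕ → ℕ → PSPerm → PSPerm
linRev i j π =
  take (i ∸ 1) π
  ++ map negE (reverse (take (suc j ∸ i) (drop (i ∸ 1) π)))
  ++ drop j π

LinStep : ℕ → PSPerm → PSPerm → Set
LinStep n π τ = ∃[ i ] ∃[ j ] (1 ≤ i × i ≤ j × j ≤ n × τ ≡ linRev i j π)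

LinSteps : ℕ → ℕ → PSPerm → PSPerm → Set
LinSteps n zero    π τ = π ≡ τ
LinSteps n (suc k) π τ = ∃[ ρ ] (LinStep n π ρ × LinSteps n k ρ τ)

LinReach : ℕ → PSPerm → ℕ → Set
LinReach n π k = ∃[ τ ] (LinSteps n k π τ × AgreesWith τ (iota n))

IsMin : (ℕ → Set) → ℕ → Set
IsMin P m = P m × (∀ k → P k → m ≤ k)

LinDist : ℕ → PSPerm → ℕ → Set
LinDist n π m = IsMin (LinReach n π) m

-- circular permutations: classes under rotations and reflections

rotate : ℕ → PSPerm → PSPerm
rotate k π = drop k π ++ take k π

reflect : PSPerm → PSPerm
reflect π = map negE (reverse π)

_∈c_ : PSPerm → PSPerm → Set
σ ∈c π = ∃[ k ] ((σ ≡ rotate k π) ⊎ (σ ≡ reflect (rotate k π)))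

circRev : ℕ → ℕ → PSPerm → PSPerm
circRev i j π with j Data.Nat.<? i
... | Relation.Nullary.yes _ =
  map negE (reverse (drop (i ∸ 1) π))
  ++ take (i ∸ 1 ∸ j) (drop j π)
  ++ map negE (reverse (take j π))
... | Relation.Nullary.no _ = linRev i j π

CircStep : ℕ → PSPerm → PSPerm → Set
CircStep n π τ = ∃[ σ ] (σ ∈c π × ∃[ i ] ∃[ j ]
  (1 ≤ i × i ≤ n × 1 ≤ j × j ≤ n × τ ≡ circRev i j σ))

CircSteps : ℕ → ℕ → PSPerm → PSPerm → Set
CircSteps n zero    π τ = π ≡ τ
CircSteps n (suc k) π τ = ∃[ ρ ] (CircStep n π ρ × CircSteps n k ρ τ)

CircAgree : ℕ → PSPerm → Set
CircAgree n π = ∃[ σ ] ∃[ ι' ] (σ ∈c π × ι' ∈c iota n × AgreesWith σ ι')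

CircReach : ℕ → PSPerm → ℕ → Set
CircReach n π k = ∃[ τ ] (CircSteps n k π τ × CircAgree n τ)

CircDist : ℕ → PSPerm → ℕ → Set
CircDist n π m = IsMin (CircReach n π) m

-- A circular reversal is a linear reversal of a representative of the class,
-- preceded and followed by a change of representative (for ρ^c(i,j) with i > j,
-- a rotation bringing the wrapping block into the interior). Conversely a block
-- reversal can be pushed past a rotation or reflection: it then acts on another
-- representative, possibly with the complementary block reversed. Pushing all
-- changes of representative of a circular sorting sequence to its start yields a
-- linear sorting sequence, no longer, from some representative, and agreement in
-- signs with ι^c transfers along the way. Since linear reversals are circular ones,
-- the two minima coincide; the least element of the linear distances is only
-- ¬¬-available constructively, which suffices because ≤ on ℕ is decidable.
module Submission where

open import Defs
open import Data.Nat using (ℕ; zero; suc; _+_; _∸_; _≤_; _<_; z≤n; s≤s; s≤s⁻¹; _<?_; _≤?_)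
open import Data.Nat.Properties
  using (≤-refl; ≤-trans; ≤-antisym; <-≤-trans; ≰⇒>; <⇒≱; m<m+n; +-monoʳ-≤; +-comm; m+n∸m≡n; m+[n∸m]≡n; n≤1+n; m≤n⇒m≤1+n)
open import Data.List using (List; []; _∷_; _++_; map; take; drop; reverse; length; upTo)
open import Data.List.Properties
  using (++-monoid; ++-identityʳ; ∷-injective; map-++; length-map; length-++; length-++-≤ˡ; length-reverse; length-upTo; reverse-++; reverse-map; reverse-involutive; take++drop≡id; drop-drop)
open import Data.List.Relation.Binary.Pointwise as Pointwise using (Pointwise; []; _∷_; ++⁺; reverse⁺; map⁺)
open import Data.List.Relation.Binary.Permutation.Propositional.Properties using (↭-length)
open import Data.Product using (_×_; _,_; proj₁; ∃-syntax)
open import Data.Sum using (_⊎_; inj₁; inj₂)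
open import Data.Empty using (⊥; ⊥-elim)
open import Function.Bundles using (_⇔_; mk⇔)
open import Relation.Nullary using (¬_; yes; no)
open import Relation.Nullary.Decidable using (decidable-stable)
open import Relation.Binary.PropositionalEquality
  using (_≡_; _≢_; refl; sym; trans; cong; cong₂; subst; module ≡-Reasoning)
open import Tactic.MonoidSolver using (solve)

isMin-exists-¬¬ : (P : ℕ → Set) → ∀ {k} → P k → ¬ ¬ (∃[ m ] IsMin P m)
isMin-exists-¬¬ P {k} pk ¬min = below-bound-absurd (suc k) ≤-refl pk
  where
  below-bound-absurd : ∀ b {j} → j < b → P j → ⊥
  below-bound-absurd (suc b) {j} j<b pj = ¬min (j , pj , minimal)
    where
    minimal : ∀ i → P i → j ≤ i
    minimal i pi with j ≤? i
    ... | yes j≤i = j≤i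
    ... | no j≰i = ⊥-elim (below-bound-absurd b (<-≤-trans (≰⇒> j≰i) (s≤s⁻¹ j<b)) pi)

isMin⇔isMin-of-minima : {A : Set} (C : A → Set) (P : ℕ → Set) (Q : A → ℕ → Set) →
  (∀ {a k} → C a → Q a k → P k) →
  (∀ {k} → P k → ∃[ a ] (C a × ∃[ k′ ] (k′ ≤ k × Q a k′))) →
  ∀ m → IsMin P m ⇔ IsMin (λ k → ∃[ a ] (C a × IsMin (Q a) k)) m
isMin⇔isMin-of-minima C P Q Q⇒P P⇒Q m = mk⇔ to from
  where
  to : IsMin P m → IsMin (λ k → ∃[ a ] (C a × IsMin (Q a) k)) m
  to (pm , m≤) with P⇒Q pm
  ... | a , ca , k′ , k′≤m , qk′ =
    (a , ca , subst (Q a) (≤-antisym k′≤m (m≤ k′ (Q⇒P ca qk′))) qk′ , λ k qk → m≤ k (Q⇒P ca qk)) ,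
    λ { k (b , cb , qk , _) → m≤ k (Q⇒P cb qk) }
  from : IsMin (λ k → ∃[ a ] (C a × IsMin (Q a) k)) m → IsMin P m
  from ((a , ca , qm , _) , m≤) = Q⇒P ca qm , minimal
    where
    minimal : ∀ k → P k → m ≤ k
    minimal k pk with P⇒Q pk
    ... | b , cb , k′ , k′≤k , qk′ = decidable-stable (m ≤? k) λ m≰k →
      isMin-exists-¬¬ (Q b) qk′ λ { (d , qd , d≤) →
        m≰k (≤-trans (m≤ d (b , cb , qd , d≤)) (≤-trans (d≤ k′ qk′) k′≤k)) }

++≡++-split : {A : Set} (xs ys us vs : List A) → xs ++ ys ≡ us ++ vs →
  ∃[ w ] (xs ≡ us ++ w × vs ≡ w ++ ys) ⊎ ∃[ w ] (us ≡ xs ++ w × ys ≡ w ++ vs)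
++≡++-split [] ys us vs eq = inj₂ (us , refl , eq)
++≡++-split (x ∷ xs) ys [] vs eq = inj₁ (x ∷ xs , refl , sym eq)
++≡++-split (x ∷ xs) ys (u ∷ us) vs eq with ∷-injective eq
... | refl , eq′ with ++≡++-split xs ys us vs eq′
...   | inj₁ (w , refl , vs≡) = inj₁ (w , refl , vs≡)
...   | inj₂ (w , refl , ys≡) = inj₂ (w , refl , ys≡)

take-length-++ : {A : Set} (xs ys : List A) → take (length xs) (xs ++ ys) ≡ xs
take-length-++ [] ys = refl
take-length-++ (x ∷ xs) ys = cong (x ∷_) (take-length-++ xs ys)

drop-length-++ : {A : Set} (xs ys : List A) → drop (length xs) (xs ++ ys) ≡ ys
drop-length-++ [] ys = refl
drop-length-++ (x ∷ xs) ys = drop-length-++ xs ys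

drop-length-++-++ : {A : Set} (xs ys zs : List A) → drop (length xs + length ys) (xs ++ ys ++ zs) ≡ zs
drop-length-++-++ [] ys zs = drop-length-++ ys zs
drop-length-++-++ (x ∷ xs) ys zs = drop-length-++-++ xs ys zs

take++take-drop++drop : {A : Set} (a b : ℕ) (xs : List A) → a ≤ b →
  xs ≡ take a xs ++ take (b ∸ a) (drop a xs) ++ drop b xs
take++take-drop++drop a b xs a≤b = sym (begin
  take a xs ++ take (b ∸ a) (drop a xs) ++ drop b xs
    ≡⟨ cong (λ ys → take a xs ++ take (b ∸ a) (drop a xs) ++ ys) drop-b ⟩
  take a xs ++ take (b ∸ a) (drop a xs) ++ drop (b ∸ a) (drop a xs)
    ≡⟨ cong (take a xs ++_) (take++drop≡id (b ∸ a) (drop a xs)) ⟩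
  take a xs ++ drop a xs
    ≡⟨ take++drop≡id a xs ⟩
  xs ∎)
  where
  open ≡-Reasoning
  drop-b : drop b xs ≡ drop (b ∸ a) (drop a xs)
  drop-b = sym (trans (drop-drop a (b ∸ a) xs) (cong (λ c → drop c xs) (m+[n∸m]≡n a≤b)))

negE-involutive : ∀ e → negE (negE e) ≡ e
negE-involutive (a , minus) = refl
negE-involutive (a , zer) = refl
negE-involutive (a , plus) = refl

map-negE-involutive : ∀ xs → map negE (map negE xs) ≡ xs
map-negE-involutive [] = refl
map-negE-involutive (x ∷ xs) = cong₂ _∷_ (negE-involutive x) (map-negE-involutive xs)

reflect-++ : ∀ xs ys → reflect (xs ++ ys) ≡ reflect ys ++ reflect xs
reflect-++ xs ys = trans (cong (map negE) (reverse-++ xs ys)) (map-++ negE (reverse ys) (reverse xs))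

reflect-++-++ : ∀ xs ys zs → reflect (xs ++ ys ++ zs) ≡ reflect zs ++ reflect ys ++ reflect xs
reflect-++-++ xs ys zs =
  trans (reflect-++ xs (ys ++ zs)) (trans (cong (_++ reflect xs) (reflect-++ ys zs)) (solve (++-monoid Entry)))

reflect-involutive : ∀ xs → reflect (reflect xs) ≡ xs
reflect-involutive xs = begin
  map negE (reverse (map negE (reverse xs))) ≡⟨ cong (map negE) (reverse-map negE (reverse xs)) ⟨
  map negE (map negE (reverse (reverse xs))) ≡⟨ map-negE-involutive (reverse (reverse xs)) ⟩
  reverse (reverse xs)                       ≡⟨ reverse-involutive xs ⟩
  xs                                         ∎
  where open ≡-Reasoning

length-reflect : ∀ xs → length (reflect xs) ≡ length xs
length-reflect xs = trans (length-map negE (reverse xs)) (length-reverse xs)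

Rotation : PSPerm → PSPerm → Set
Rotation π σ = ∃[ xs ] ∃[ ys ] (π ≡ xs ++ ys × σ ≡ ys ++ xs)

CircEquiv : PSPerm → PSPerm → Set
CircEquiv π σ = Rotation π σ ⊎ Rotation (reflect π) σ

rotation-refl : ∀ π → Rotation π π
rotation-refl π = [] , π , refl , sym (++-identityʳ π)

rotation-sym : ∀ {π σ} → Rotation π σ → Rotation σ π
rotation-sym (xs , ys , π≡ , σ≡) = ys , xs , σ≡ , π≡

rotation-trans : ∀ {π σ τ} → Rotation π σ → Rotation σ τ → Rotation π τ
rotation-trans (xs , ys , refl , refl) (us , vs , eq , refl) with ++≡++-split ys xs us vs eq
... | inj₁ (w , refl , refl) = xs ++ us , w , solve (++-monoid Entry) , solve (++-monoid Entry)
... | inj₂ (w , refl , refl) = w , vs ++ ys , solve (++-monoid Entry) , solve (++-monoid Entry)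

rotation-reflect : ∀ {π σ} → Rotation π σ → Rotation (reflect π) (reflect σ)
rotation-reflect (xs , ys , refl , refl) = reflect ys , reflect xs , reflect-++ xs ys , reflect-++ ys xs

length-rotation : ∀ {π σ} → Rotation π σ → length σ ≡ length π
length-rotation (xs , ys , refl , refl) = begin
  length (ys ++ xs)         ≡⟨ length-++ ys ⟩
  length ys + length xs     ≡⟨ +-comm (length ys) (length xs) ⟩
  length xs + length ys     ≡⟨ length-++ xs ⟨
  length (xs ++ ys)         ∎
  where open ≡-Reasoning

circEquiv-refl : ∀ π → CircEquiv π π
circEquiv-refl π = inj₁ (rotation-refl π)

circEquiv-reflect : ∀ π → CircEquiv π (reflect π)
circEquiv-reflect π = inj₂ (rotation-refl (reflect π))

circEquiv-trans : ∀ {π σ τ} → CircEquiv π σ → CircEquiv σ τ → CircEquiv π τ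
circEquiv-trans (inj₁ r) (inj₁ s) = inj₁ (rotation-trans r s)
circEquiv-trans (inj₁ r) (inj₂ s) = inj₂ (rotation-trans (rotation-reflect r) s)
circEquiv-trans (inj₂ r) (inj₁ s) = inj₂ (rotation-trans r s)
circEquiv-trans {π} (inj₂ r) (inj₂ s) =
  inj₁ (subst (λ ρ → Rotation ρ _) (reflect-involutive π) (rotation-trans (rotation-reflect r) s))

circEquiv-sym : ∀ {π σ} → CircEquiv π σ → CircEquiv σ π
circEquiv-sym (inj₁ r) = inj₁ (rotation-sym r)
circEquiv-sym {π} (inj₂ r) =
  inj₂ (subst (Rotation _) (reflect-involutive π) (rotation-reflect (rotation-sym r)))

length-circEquiv : ∀ {π σ} → CircEquiv π σ → length σ ≡ length π
length-circEquiv (inj₁ r) = length-rotation r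
length-circEquiv {π} (inj₂ r) = trans (length-rotation r) (length-reflect π)

rotate-length-++ : ∀ xs ys → rotate (length xs) (xs ++ ys) ≡ ys ++ xs
rotate-length-++ xs ys = cong₂ _++_ (drop-length-++ xs ys) (take-length-++ xs ys)

rotation-rotate : ∀ k π → Rotation π (rotate k π)
rotation-rotate k π = take k π , drop k π , sym (take++drop≡id k π) , refl

∈c⇒circEquiv : ∀ {σ π} → σ ∈c π → CircEquiv π σ
∈c⇒circEquiv {π = π} (k , inj₁ refl) = inj₁ (rotation-rotate k π)
∈c⇒circEquiv {π = π} (k , inj₂ refl) = inj₂ (rotation-reflect (rotation-rotate k π))

circEquiv⇒∈c : ∀ {π σ} → CircEquiv π σ → σ ∈c π
circEquiv⇒∈c (inj₁ (xs , ys , refl , refl)) = length xs , inj₁ (sym (rotate-length-++ xs ys))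
circEquiv⇒∈c {π} (inj₂ (xs , ys , rπ≡ , refl)) = length (reflect ys) , inj₂ (sym (begin
  reflect (rotate (length (reflect ys)) π)
    ≡⟨ cong (λ ρ → reflect (rotate (length (reflect ys)) ρ)) π≡ ⟩
  reflect (rotate (length (reflect ys)) (reflect ys ++ reflect xs))
    ≡⟨ cong reflect (rotate-length-++ (reflect ys) (reflect xs)) ⟩
  reflect (reflect xs ++ reflect ys)
    ≡⟨ reflect-++ (reflect xs) (reflect ys) ⟩
  reflect (reflect ys) ++ reflect (reflect xs)
    ≡⟨ cong₂ _++_ (reflect-involutive ys) (reflect-involutive xs) ⟩
  ys ++ xs ∎))
  where
  open ≡-Reasoning
  π≡ : π ≡ reflect ys ++ reflect xs
  π≡ = trans (sym (reflect-involutive π)) (trans (cong reflect rπ≡) (reflect-++ xs ys))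

BlockReversal : PSPerm → PSPerm → Set
BlockReversal σ τ = ∃[ xs ] ∃[ ys ] ∃[ zs ] (σ ≡ xs ++ ys ++ zs × τ ≡ xs ++ reflect ys ++ zs)

length-blockReversal : ∀ {σ τ} → BlockReversal σ τ → length τ ≡ length σ
length-blockReversal (xs , ys , zs , refl , refl) = begin
  length (xs ++ reflect ys ++ zs)            ≡⟨ length-++ xs ⟩
  length xs + length (reflect ys ++ zs)      ≡⟨ cong (length xs +_) (length-++ (reflect ys)) ⟩
  length xs + (length (reflect ys) + length zs)
    ≡⟨ cong (λ l → length xs + (l + length zs)) (length-reflect ys) ⟩
  length xs + (length ys + length zs)        ≡⟨ cong (length xs +_) (length-++ ys) ⟨
  length xs + length (ys ++ zs)              ≡⟨ length-++ xs ⟨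
  length (xs ++ ys ++ zs)                    ∎
  where open ≡-Reasoning

blockReversal-reflect : ∀ {σ τ} → BlockReversal σ τ → BlockReversal (reflect σ) (reflect τ)
blockReversal-reflect (xs , ys , zs , refl , refl) =
  reflect zs , reflect ys , reflect xs , reflect-++-++ xs ys zs , reflect-++-++ xs (reflect ys) zs

-- According as the cut of the rotation falls in xs, in the reversed block or
-- in zs; in the middle case σ is reflected and the complementary block zs ++ xs
-- is the one reversed.
blockReversal-rotation : ∀ {σ τ τ′} → BlockReversal σ τ → Rotation τ τ′ →
  ∃[ σ′ ] (CircEquiv σ σ′ × BlockReversal σ′ τ′)
blockReversal-rotation (xs , ys , zs , refl , refl) (us , vs , eq , refl)
  with ++≡++-split xs (reflect ys ++ zs) us vs eq
... | inj₁ (w , refl , refl) =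
  w ++ ys ++ zs ++ us ,
  inj₁ (us , w ++ ys ++ zs , solve (++-monoid Entry) , solve (++-monoid Entry)) ,
  (w , ys , zs ++ us , refl , solve (++-monoid Entry))
... | inj₂ (w , refl , eq′) with ++≡++-split (reflect ys) zs w vs eq′
...   | inj₁ (w′ , ys≡ , refl) =
  w′ ++ reflect (zs ++ xs) ++ w ,
  inj₂ (reflect zs ++ w , w′ ++ reflect xs , reflected , rotated) ,
  (w′ , reflect (zs ++ xs) , w , refl , reversed)
  where
  open ≡-Reasoning
  reflected : reflect (xs ++ ys ++ zs) ≡ (reflect zs ++ w) ++ w′ ++ reflect xs
  reflected = begin
    reflect (xs ++ ys ++ zs)                 ≡⟨ reflect-++-++ xs ys zs ⟩
    reflect zs ++ reflect ys ++ reflect xs   ≡⟨ cong (λ b → reflect zs ++ b ++ reflect xs) ys≡ ⟩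
    reflect zs ++ (w ++ w′) ++ reflect xs    ≡⟨ solve (++-monoid Entry) ⟩
    (reflect zs ++ w) ++ w′ ++ reflect xs    ∎
  rotated : w′ ++ reflect (zs ++ xs) ++ w ≡ (w′ ++ reflect xs) ++ reflect zs ++ w
  rotated = begin
    w′ ++ reflect (zs ++ xs) ++ w            ≡⟨ cong (λ b → w′ ++ b ++ w) (reflect-++ zs xs) ⟩
    w′ ++ (reflect xs ++ reflect zs) ++ w    ≡⟨ solve (++-monoid Entry) ⟩
    (w′ ++ reflect xs) ++ reflect zs ++ w    ∎
  reversed : (w′ ++ zs) ++ xs ++ w ≡ w′ ++ reflect (reflect (zs ++ xs)) ++ w
  reversed = begin
    (w′ ++ zs) ++ xs ++ w                    ≡⟨ solve (++-monoid Entry) ⟩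
    w′ ++ (zs ++ xs) ++ w                    ≡⟨ cong (λ b → w′ ++ b ++ w) (reflect-involutive (zs ++ xs)) ⟨
    w′ ++ reflect (reflect (zs ++ xs)) ++ w  ∎
...   | inj₂ (w′ , refl , refl) =
  vs ++ xs ++ ys ++ w′ ,
  inj₁ (xs ++ ys ++ w′ , vs , solve (++-monoid Entry) , refl) ,
  (vs ++ xs , ys , w′ , solve (++-monoid Entry) , solve (++-monoid Entry))

blockReversal-circEquiv : ∀ {σ τ τ′} → BlockReversal σ τ → CircEquiv τ τ′ →
  ∃[ σ′ ] (CircEquiv σ σ′ × BlockReversal σ′ τ′)
blockReversal-circEquiv rev (inj₁ r) = blockReversal-rotation rev r
blockReversal-circEquiv {σ} rev (inj₂ r) with blockReversal-rotation (blockReversal-reflect rev) r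
... | σ′ , e , rev′ = σ′ , circEquiv-trans (circEquiv-reflect σ) e , rev′

circRev-factorisation : ∀ i j σ → 1 ≤ i →
  ∃[ σ′ ] ∃[ τ′ ] (CircEquiv σ σ′ × BlockReversal σ′ τ′ × CircEquiv τ′ (circRev i j σ))
circRev-factorisation (suc i) j σ (s≤s z≤n) with j <? suc i
... | no j≮1+i =
  σ , linRev (suc i) j σ , circEquiv-refl σ ,
  (take i σ , take (j ∸ i) (drop i σ) , drop j σ ,
   take++take-drop++drop i j σ (≤-trans (n≤1+n i) (s≤s⁻¹ (≰⇒> j≮1+i))) , refl) ,
  circEquiv-refl _
... | yes j<1+i =
  middle ++ (tail ++ head) ++ [] , middle ++ reflect (tail ++ head) ++ [] ,
  inj₁ (head , middle ++ tail , take++take-drop++drop j i σ (s≤s⁻¹ j<1+i) , solve (++-monoid Entry)) ,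
  (middle , tail ++ head , [] , refl , refl) ,
  inj₁ (middle ++ reflect head , reflect tail , reversed , refl)
  where
  head = take j σ
  middle = take (i ∸ j) (drop j σ)
  tail = drop i σ
  reversed : middle ++ reflect (tail ++ head) ++ [] ≡ (middle ++ reflect head) ++ reflect tail
  reversed = begin
    middle ++ reflect (tail ++ head) ++ []       ≡⟨ cong (λ b → middle ++ b ++ []) (reflect-++ tail head) ⟩
    middle ++ (reflect head ++ reflect tail) ++ [] ≡⟨ solve (++-monoid Entry) ⟩
    (middle ++ reflect head) ++ reflect tail      ∎
    where open ≡-Reasoning

circStep-factorisation : ∀ {n π ρ} → CircStep n π ρ →
  ∃[ σ′ ] ∃[ τ′ ] (CircEquiv π σ′ × BlockReversal σ′ τ′ × CircEquiv τ′ ρ)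
circStep-factorisation (σ , σ∈π , i , j , 1≤i , _ , _ , _ , refl) with circRev-factorisation i j σ 1≤i
... | σ′ , τ′ , e , rev , e′ = σ′ , τ′ , circEquiv-trans (∈c⇒circEquiv σ∈π) e , rev , e′

length-circStep : ∀ {n π ρ} → CircStep n π ρ → length ρ ≡ length π
length-circStep step with circStep-factorisation step
... | σ′ , τ′ , e , rev , e′ =
  trans (length-circEquiv e′) (trans (length-blockReversal rev) (length-circEquiv e))

circStep-lift : ∀ {n π ρ ρ′} → CircStep n π ρ → CircEquiv ρ ρ′ →
  ∃[ π′ ] (CircEquiv π π′ × BlockReversal π′ ρ′)
circStep-lift step e″ with circStep-factorisation step
... | σ′ , τ′ , e , rev , e′ with blockReversal-circEquiv rev (circEquiv-trans e′ e″)
...   | π′ , e‴ , rev′ = π′ , circEquiv-trans e e‴ , rev′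

linRev-block : ∀ xs ys zs →
  linRev (suc (length xs)) (length xs + length ys) (xs ++ ys ++ zs) ≡ xs ++ reflect ys ++ zs
linRev-block xs ys zs
  rewrite take-length-++ xs (ys ++ zs) | drop-length-++ xs (ys ++ zs) | m+n∸m≡n (length xs) (length ys)
        | take-length-++ ys zs | drop-length-++-++ xs ys zs = refl

-- An empty block gives no linear reversal, since ρ(i,j) requires i ≤ j.
blockReversal⇒linStep : ∀ {n σ τ} → BlockReversal σ τ → length σ ≡ n → σ ≡ τ ⊎ LinStep n σ τ
blockReversal⇒linStep (xs , [] , zs , refl , refl) _ = inj₁ refl
blockReversal⇒linStep (xs , y ∷ ys , zs , refl , refl) refl =
  inj₂ (suc (length xs) , length xs + length (y ∷ ys) , s≤s z≤n , m<m+n (length xs) (s≤s z≤n) ,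
        subst (_ ≤_) (sym (length-++ xs)) (+-monoʳ-≤ (length xs) (length-++-≤ˡ (y ∷ ys))) ,
        sym (linRev-block xs (y ∷ ys) zs))

Pointwise-++ʳ⁻ : {A B : Set} {R : A → B → Set} {as : List A} (xs ys : List B) → Pointwise R as (xs ++ ys) →
  ∃[ as₁ ] ∃[ as₂ ] (as ≡ as₁ ++ as₂ × Pointwise R as₁ xs × Pointwise R as₂ ys)
Pointwise-++ʳ⁻ [] ys rs = [] , _ , refl , [] , rs
Pointwise-++ʳ⁻ (x ∷ xs) ys (r ∷ rs) with Pointwise-++ʳ⁻ xs ys rs
... | as₁ , as₂ , refl , rs₁ , rs₂ = _ ∷ as₁ , as₂ , refl , r ∷ rs₁ , rs₂

entryAgree-negE : ∀ {x y} → EntryAgree x y → EntryAgree (negE x) (negE y)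
entryAgree-negE {a , s} {b , t} (a≡b , s≡t) = a≡b , negS-agree s s≡t
  where
  negS-agree : ∀ s → (s ≢ zer → s ≡ t) → negS s ≢ zer → negS s ≡ negS t
  negS-agree minus s≡t _ = cong negS (s≡t λ ())
  negS-agree zer _ -s≢0 = ⊥-elim (-s≢0 refl)
  negS-agree plus s≡t _ = cong negS (s≡t λ ())

agreesWith-reflect : ∀ {σ ι} → AgreesWith σ ι → AgreesWith (reflect σ) (reflect ι)
agreesWith-reflect agrees = map⁺ negE negE (Pointwise.map entryAgree-negE (reverse⁺ agrees))

agreesWith-rotation : ∀ {σ ι ι′} → AgreesWith σ ι → Rotation ι ι′ →
  ∃[ σ′ ] (Rotation σ σ′ × AgreesWith σ′ ι′)
agreesWith-rotation agrees (xs , ys , refl , refl) with Pointwise-++ʳ⁻ xs ys agrees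
... | σ₁ , σ₂ , refl , agrees₁ , agrees₂ = σ₂ ++ σ₁ , (σ₁ , σ₂ , refl , refl) , ++⁺ agrees₂ agrees₁

agreesWith-circEquiv : ∀ {σ ι ι′} → AgreesWith σ ι → CircEquiv ι ι′ →
  ∃[ σ′ ] (CircEquiv σ σ′ × AgreesWith σ′ ι′)
agreesWith-circEquiv agrees (inj₁ r) with agreesWith-rotation agrees r
... | σ′ , r′ , agrees′ = σ′ , inj₁ r′ , agrees′
agreesWith-circEquiv agrees (inj₂ r) with agreesWith-rotation (agreesWith-reflect agrees) r
... | σ′ , r′ , agrees′ = σ′ , inj₂ r′ , agrees′

circSteps⇒linSteps : ∀ {n} k {π τ τ′} → length π ≡ n → CircSteps n k π τ → CircEquiv τ τ′ →
  ∃[ σ ] (CircEquiv π σ × ∃[ k′ ] (k′ ≤ k × LinSteps n k′ σ τ′))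
circSteps⇒linSteps zero _ refl e = _ , e , zero , z≤n , refl
circSteps⇒linSteps (suc k) len (ρ , step , steps) e
  with circSteps⇒linSteps k (trans (length-circStep step) len) steps e
... | σ₁ , ρ∼σ₁ , k′ , k′≤k , lin with circStep-lift step ρ∼σ₁
...   | σ₀ , π∼σ₀ , rev with blockReversal⇒linStep rev (trans (length-circEquiv π∼σ₀) len)
...     | inj₁ refl = σ₀ , π∼σ₀ , k′ , m≤n⇒m≤1+n k′≤k , lin
...     | inj₂ linStep = σ₀ , π∼σ₀ , suc k′ , s≤s k′≤k , σ₁ , linStep , lin

circReach⇒linReach : ∀ {n π} k → length π ≡ n → CircReach n π k →
  ∃[ σ ] (σ ∈c π × ∃[ k′ ] (k′ ≤ k × LinReach n σ k′))
circReach⇒linReach k len (τ , steps , σ , ι′ , σ∈τ , ι′∈ι , agrees)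
  with agreesWith-circEquiv agrees (circEquiv-sym (∈c⇒circEquiv ι′∈ι))
... | τ′ , σ∼τ′ , agrees′ with circSteps⇒linSteps k len steps (circEquiv-trans (∈c⇒circEquiv σ∈τ) σ∼τ′)
...   | σ₀ , π∼σ₀ , k′ , k′≤k , lin = σ₀ , circEquiv⇒∈c π∼σ₀ , k′ , k′≤k , τ′ , lin , agrees′

∈c-refl : ∀ π → π ∈c π
∈c-refl π = circEquiv⇒∈c (circEquiv-refl π)

circRev-≤ : ∀ {i j} σ → i ≤ j → circRev i j σ ≡ linRev i j σ
circRev-≤ {i} {j} σ i≤j with j <? i
... | yes j<i = ⊥-elim (<⇒≱ j<i i≤j)
... | no _ = refl

linStep⇒circStep : ∀ {n σ π ρ} → σ ∈c π → LinStep n σ ρ → CircStep n π ρ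
linStep⇒circStep {σ = σ} σ∈π (i , j , 1≤i , i≤j , j≤n , refl) =
  σ , σ∈π , i , j , 1≤i , ≤-trans i≤j j≤n , ≤-trans 1≤i i≤j , j≤n , sym (circRev-≤ σ i≤j)

linReach⇒circReach : ∀ {n σ π} k → σ ∈c π → LinReach n σ k → CircReach n π k
linReach⇒circReach {n} {π = π} zero σ∈π (σ , refl , agrees) =
  π , refl , σ , iota n , σ∈π , ∈c-refl (iota n) , agrees
linReach⇒circReach (suc k) σ∈π (τ , (ρ , step , steps) , agrees)
  with linReach⇒circReach k (∈c-refl ρ) (τ , steps , agrees)
... | τ′ , circSteps , circAgree = τ′ , (ρ , linStep⇒circStep σ∈π step , circSteps) , circAgree

isPerm⇒length : ∀ {n π} → IsPerm n π → length π ≡ n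
isPerm⇒length {n} {π} perm = begin
  length π                    ≡⟨ length-map proj₁ π ⟨
  length (map proj₁ π)        ≡⟨ ↭-length perm ⟩
  length (map suc (upTo n))   ≡⟨ length-map suc (upTo n) ⟩
  length (upTo n)             ≡⟨ length-upTo n ⟩
  n                           ∎
  where open ≡-Reasoning

lemma11 : (n : ℕ) (π : PSPerm) → IsPerm n π → (m : ℕ) →
    CircDist n π m ⇔ IsMin (λ k → ∃[ σ ] (σ ∈c π × LinDist n σ k)) m
lemma11 n π perm =
  isMin⇔isMin-of-minima (_∈c π) (CircReach n π) (LinReach n)
    (linReach⇒circReach _) (circReach⇒linReach _ (isPerm⇒length perm))
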